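{- Let $G$ be a graph whose twin graph $G^*$ is isomorphic to a triangle with a pendant edge (vertices: two degree-2 vertices, one degree-3 vertex, one leaf), where one degree-2 vertex is of type (N), the other degree-2 vertex is of type (1K), the leaf is of type (1N), and moreover, if the degree-2 vertex of type (1K) is of type (K), then neither the leaf nor the degree-3 vertex is of type (N). Then $D(G)\neq n(G)-2$.
   Context: All graphs are finite and simple; $n(G)$ is the number of vertices. Two vertices $u,v$ are twins if $N_G(v)\setminus\{u\}=N_G(u)\setminus\{v\}$; the relation "$u=v$ or $u,v$ twins" is an equivalence relation with class $v^*$ of $v$. The twin graph $G^*$ has vertex set $\{v^*\}$ and edges $u^*v^*$ for $uv\in E(G)$. $v^*$ is of type (1) if $|v^*|=1$, of type (K) if it induces $K_r$ with $r\geq 2$, of type (N) if it induces the edgeless graph $\overline{K_r}$ with $r\geq 2$; type (1K) means (1) or (K), type (1N) means (1) or (N). $D(G)$ is the minimum number of colors in a vertex coloring preserved by no non-trivial automorphism of $G$. -}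

module Defs where

open import Data.Nat using (ℕ; _≤_)
open import Data.Fin using (Fin; zero; suc)
open import Data.Bool using (Bool; true; false)
open import Data.Product using (Σ; ∃; _×_; _,_)
open import Data.Sum using (_⊎_)
open import Relation.Binary.PropositionalEquality using (_≡_; _≢_)
open import Relation.Nullary using (¬_)
open import Function.Definitions using (Injective)

record Graph (n : ℕ) : Set where
  field
    adj    : Fin n → Fin n → Bool
    sym    : ∀ u v → adj u v ≡ adj v u
    irrefl : ∀ v → adj v v ≡ false
open Graph public

Adj : ∀ {n} → Graph n → Fin n → Fin n → Set
Adj G u v = adj G u v ≡ true

-- u, v are twins: N(v) \ {u} = N(u) \ {v}
-- (since the graph is loopless this amounts to: every w ∉ {u,v} is adjacent to u iff to v)
Twins : ∀ {n} → Graph n → Fin n → Fin n → Set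
Twins G u v = ∀ w → w ≢ u → w ≢ v → adj G u w ≡ adj G v w

TwinRel : ∀ {n} → Graph n → Fin n → Fin n → Set
TwinRel G u v = (u ≡ v) ⊎ Twins G u v

-- The paw (triangle with a pendant edge) on Fin 4:
--   0 : degree-2 vertex (the one of type (N))
--   1 : degree-2 vertex (the one of type (1K))
--   2 : degree-3 vertex
--   3 : leaf
-- edges: 01, 02, 12, 23
pawAdj : Fin 4 → Fin 4 → Bool
pawAdj zero (suc zero) = true
pawAdj zero (suc (suc zero)) = true
pawAdj (suc zero) zero = true
pawAdj (suc zero) (suc (suc zero)) = true
pawAdj (suc (suc zero)) zero = true
pawAdj (suc (suc zero)) (suc zero) = true
pawAdj (suc (suc zero)) (suc (suc (suc zero))) = true
pawAdj (suc (suc (suc zero))) (suc (suc zero)) = true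
pawAdj _ _ = false

-- f : V(G) → Fin 4 realises an isomorphism G* ≅ paw:
-- f is surjective, its fibres are exactly the twin classes,
-- and for vertices in distinct classes u*v* ∈ E(G*) iff f u f v ∈ E(paw).
TwinGraphIsPaw : ∀ {n} → Graph n → (Fin n → Fin 4) → Set
TwinGraphIsPaw G f =
  (∀ i → ∃ λ v → f v ≡ i) ×
  (∀ u v → (f u ≡ f v → TwinRel G u v) × (TwinRel G u v → f u ≡ f v)) ×
  (∀ u v → f u ≢ f v → adj G u v ≡ pawAdj (f u) (f v))

Class≥2 : ∀ {n} → (Fin n → Fin 4) → Fin 4 → Set
Class≥2 f i = Σ _ λ u → Σ _ λ v → u ≢ v × f u ≡ i × f v ≡ i

ClassClique : ∀ {n} → Graph n → (Fin n → Fin 4) → Fin 4 → Set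
ClassClique G f i = ∀ u v → f u ≡ i → f v ≡ i → u ≢ v → adj G u v ≡ true

ClassIndep : ∀ {n} → Graph n → (Fin n → Fin 4) → Fin 4 → Set
ClassIndep G f i = ∀ u v → f u ≡ i → f v ≡ i → adj G u v ≡ false

Type1 : ∀ {n} → (Fin n → Fin 4) → Fin 4 → Set
Type1 f i = ¬ Class≥2 f i

TypeK : ∀ {n} → Graph n → (Fin n → Fin 4) → Fin 4 → Set
TypeK G f i = Class≥2 f i × ClassClique G f i

TypeN : ∀ {n} → Graph n → (Fin n → Fin 4) → Fin 4 → Set
TypeN G f i = Class≥2 f i × ClassIndep G f i

Type1K : ∀ {n} → Graph n → (Fin n → Fin 4) → Fin 4 → Set
Type1K G f i = Type1 f i ⊎ TypeK G f i

Type1N : ∀ {n} → Graph n → (Fin n → Fin 4) → Fin 4 → Set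
Type1N G f i = Type1 f i ⊎ TypeN G f i

-- Automorphisms: injective (hence bijective, Fin n finite) adjacency-preserving maps
IsAut : ∀ {n} → Graph n → (Fin n → Fin n) → Set
IsAut G σ = Injective _≡_ _≡_ σ × (∀ u v → adj G (σ u) (σ v) ≡ adj G u v)

Distinguishing : ∀ {n} → Graph n → (k : ℕ) → (Fin n → Fin k) → Set
Distinguishing G k c = ∀ σ → IsAut G σ → (∀ v → c (σ v) ≡ c v) → ∀ v → σ v ≡ v

HasDistColoring : ∀ {n} → Graph n → ℕ → Set
HasDistColoring G k = Σ _ λ c → Distinguishing G k c

IsDistNumber : ∀ {n} → Graph n → ℕ → Set
IsDistNumber G k = HasDistColoring G k × (∀ j → HasDistColoring G j → k ≤ j)

{-# OPTIONS --safe #-}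
-- Give the four representatives r₀, …, r₃ of the twin classes one common colour and
-- every other vertex a colour of its own: n − 3 colours. An automorphism preserving
-- this colouring fixes every other vertex and permutes the representatives by an
-- automorphism of the paw, so it is the identity or swaps the two degree-2 classes.
-- The swap is impossible: a second vertex w of the class of r₀ is fixed, adjacent to
-- r₁, and (class of type (N)) not adjacent to r₀. Hence D(G) ≤ n − 3 < n − 2.
module Submission where

open import Defs hiding (sym)
open import Data.Nat using (ℕ; zero; suc; _+_; _∸_; _≤_)
open import Data.Nat.Properties using (+-suc; 1+n≰n)
open import Data.Fin using (Fin; zero; suc; punchOut)
open import Data.Fin.Properties using (_≟_; all?; punchOut-injective; suc-injective; 0≢1+n)
open import Data.Bool using (false)
import Data.Bool.Properties as Bool
open import Data.Vec using (_∷_; []; lookup; tabulate)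
open import Data.Vec.Properties using (lookup∘tabulate)
open import Data.Product using (Σ; ∃-syntax; _×_; _,_; proj₁; proj₂)
import Data.Product as Product
open import Data.Sum using (_⊎_; inj₁; inj₂; [_,_]′; map₂)
import Data.Sum as Sum
open import Data.Empty using (⊥-elim)
open import Function using (id; _∘_)
open import Function.Definitions using (Injective)
open import Relation.Nullary using (¬_; yes; no; contradiction)
open import Relation.Nullary.Decidable using (Dec; toWitness; _→-dec_; _⊎-dec_)
open import Relation.Binary.PropositionalEquality
  using (_≡_; _≢_; refl; sym; trans; cong; cong₂; subst; _≗_; module ≡-Reasoning)

InjectiveOutside : {A B : Set} → (A → Set) → (A → B) → Set
InjectiveOutside S c = ∀ u v → c u ≡ c v → u ≡ v ⊎ (S u × S v)

InjectiveOutside-mono : {A B : Set} {S T : A → Set} {c : A → B} →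
  (∀ {u} → S u → T u) → InjectiveOutside S c → InjectiveOutside T c
InjectiveOutside-mono S⊆T c-inj u v = map₂ (Product.map S⊆T S⊆T) ∘ c-inj u v

same-colour : {A B : Set} {S : A → Set} {c : A → B} → InjectiveOutside S c →
  ∀ {u v} → c u ≡ c v → u ≡ v ⊎ S u
same-colour c-inj {u} {v} = map₂ proj₁ ∘ c-inj u v

merge : ∀ {m} {i j : Fin (suc m)} → i ≢ j → Fin (suc m) → Fin m
merge {i = i} i≢j v with i ≟ v
... | yes _ = punchOut i≢j
... | no i≢v = punchOut i≢v

merge-injectiveOutside : ∀ {m} {i j : Fin (suc m)} (i≢j : i ≢ j) →
  InjectiveOutside (λ v → v ≡ i ⊎ v ≡ j) (merge i≢j)
merge-injectiveOutside {i = i} i≢j u v e with i ≟ u | i ≟ v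
... | yes refl | yes refl = inj₁ refl
... | yes refl | no i≢v   = inj₂ (inj₁ refl , inj₂ (sym (punchOut-injective i≢j i≢v e)))
... | no i≢u   | yes refl = inj₂ (inj₂ (punchOut-injective i≢u i≢j e) , inj₁ refl)
... | no i≢u   | no i≢v   = inj₁ (punchOut-injective i≢u i≢v e)

merge-colours : ∀ {n k} {S : Fin n → Set} {c : Fin n → Fin k} {a b : Fin n} →
  InjectiveOutside S c → S a → ¬ S b →
  ∃[ k′ ] k ≡ suc k′ × Σ (Fin n → Fin k′) (InjectiveOutside (λ u → S u ⊎ u ≡ b))
merge-colours {k = 0} {c = c} {a = a} _ _ _ with c a
... | ()
merge-colours {k = suc k} {S} {c} {a} {b} c-inj a∈S b∉S =
  k , refl , merge cb≢ca ∘ c , λ u v e →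
    [ map₂ (Product.map inj₁ inj₁) ∘ c-inj u v , inj₂ ∘ Product.map into into ]′
      (merge-injectiveOutside cb≢ca (c u) (c v) e)
  where
  cb≢ca : c b ≢ c a
  cb≢ca e = [ (λ { refl → b∉S a∈S }) , b∉S ]′ (same-colour c-inj e)

  into : ∀ {u} → c u ≡ c b ⊎ c u ≡ c a → S u ⊎ u ≡ b
  into (inj₁ e) = Sum.swap (same-colour c-inj e)
  into (inj₂ e) = inj₁ ([ (λ { refl → a∈S }) , id ]′ (same-colour c-inj e))

collapse : ∀ {n} m (r : Fin (suc m) → Fin n) → Injective _≡_ _≡_ r →
  ∃[ k ] n ≡ m + k × Σ (Fin n → Fin k) (InjectiveOutside (λ u → ∃[ i ] u ≡ r i))
collapse zero r _ = _ , refl , id , λ _ _ → inj₁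
collapse (suc m) r r-inj with collapse m (r ∘ suc) (suc-injective ∘ r-inj)
... | k , n≡m+k , c , c-inj
    with merge-colours c-inj (zero , refl) (λ (i , e) → 0≢1+n (r-inj e))
... | k′ , refl , c′ , c′-inj =
  k′ , trans n≡m+k (+-suc m k′) , c′ ,
  InjectiveOutside-mono [ (λ (i , e) → suc i , e) , (λ e → zero , e) ]′ c′-inj

IsPawAutomorphism : (Fin 4 → Fin 4) → Set
IsPawAutomorphism g = ∀ i j → pawAdj (g i) (g j) ≡ pawAdj i j

IsPawAutomorphism-resp-≗ : ∀ {g h} → g ≗ h → IsPawAutomorphism g → IsPawAutomorphism h
IsPawAutomorphism-resp-≗ g≗h g-aut i j =
  trans (cong₂ pawAdj (sym (g≗h i)) (sym (g≗h j))) (g-aut i j)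

swap01 : Fin 4 → Fin 4
swap01 zero       = suc zero
swap01 (suc zero) = zero
swap01 i          = i

pawAdj-irrefl : ∀ i → pawAdj i i ≡ false
pawAdj-irrefl zero                   = refl
pawAdj-irrefl (suc zero)             = refl
pawAdj-irrefl (suc (suc zero))       = refl
pawAdj-irrefl (suc (suc (suc zero))) = refl

isPawAutomorphism? : ∀ g → Dec (IsPawAutomorphism g)
isPawAutomorphism? g = all? λ i → all? λ j → pawAdj (g i) (g j) Bool.≟ pawAdj i j

_≗?_ : (g h : Fin 4 → Fin 4) → Dec (g ≗ h)
g ≗? h = all? λ i → g i ≟ h i

-- Checked by evaluation over all 4⁴ value tables.
paw-automorphisms-table : ∀ a b c d → let g = lookup (a ∷ b ∷ c ∷ d ∷ []) in
  IsPawAutomorphism g → g ≗ id ⊎ g ≗ swap01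
paw-automorphisms-table = toWitness {a? = all? λ a → all? λ b → all? λ c → all? λ d →
  let g = lookup (a ∷ b ∷ c ∷ d ∷ []) in isPawAutomorphism? g →-dec (g ≗? id ⊎-dec g ≗? swap01)} _

paw-automorphisms : ∀ g → IsPawAutomorphism g → g ≗ id ⊎ g ≗ swap01
paw-automorphisms g g-aut =
  Sum.map untable untable
    (paw-automorphisms-table (g zero) (g (suc zero)) (g (suc (suc zero))) (g (suc (suc (suc zero))))
      (IsPawAutomorphism-resp-≗ (sym ∘ lookup∘tabulate g) g-aut))
  where
  untable : ∀ {h} → lookup (tabulate g) ≗ h → g ≗ h
  untable table≗h i = trans (sym (lookup∘tabulate g i)) (table≗h i)

another-member : ∀ {n} {f : Fin n → Fin 4} {i} → Class≥2 f i → ∀ x → ∃[ w ] f w ≡ i × w ≢ x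
another-member (u , v , u≢v , fu≡i , fv≡i) x with u ≟ x
... | yes refl = v , fv≡i , u≢v ∘ sym
... | no u≢x   = u , fu≡i , u≢x

module PawTwinGraph {n} (G : Graph n) (f : Fin n → Fin 4) (paw : TwinGraphIsPaw G f) where

  rep : Fin 4 → Fin n
  rep i = proj₁ (proj₁ paw i)

  f-rep : ∀ i → f (rep i) ≡ i
  f-rep i = proj₂ (proj₁ paw i)

  rep-injective : Injective _≡_ _≡_ rep
  rep-injective {i} {j} e = trans (sym (f-rep i)) (trans (cong f e) (f-rep j))

  IsRep : Fin n → Set
  IsRep u = ∃[ i ] u ≡ rep i

  isRep⇒≡rep : ∀ {u i} → f u ≡ i → IsRep u → u ≡ rep i
  isRep⇒≡rep fu≡i (j , refl) = cong rep (trans (sym (f-rep j)) fu≡i)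

  adj-across-classes : ∀ {u v i j} → f u ≡ i → f v ≡ j → i ≢ j → adj G u v ≡ pawAdj i j
  adj-across-classes refl refl i≢j = proj₂ (proj₂ paw) _ _ i≢j

  adj-rep : ∀ i j → adj G (rep i) (rep j) ≡ pawAdj i j
  adj-rep i j with i ≟ j
  ... | yes refl = trans (irrefl G (rep i)) (sym (pawAdj-irrefl i))
  ... | no i≢j   = adj-across-classes (f-rep i) (f-rep j) i≢j

  module ColourPreserving {k} {c : Fin n → Fin k} (c-inj : InjectiveOutside IsRep c)
    {σ} (σ-aut : IsAut G σ) (σ-pres : ∀ v → c (σ v) ≡ c v) where

    fixes-nonRep : ∀ {v} → ¬ IsRep v → σ v ≡ v
    fixes-nonRep v∉ = [ id , (λ (_ , v∈) → contradiction v∈ v∉) ]′ (c-inj _ _ (σ-pres _))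

    permutes-reps : ∀ i → ∃[ j ] σ (rep i) ≡ rep j
    permutes-reps i = [ (λ e → i , e) , id ]′ (same-colour c-inj (σ-pres (rep i)))

    induced : Fin 4 → Fin 4
    induced = proj₁ ∘ permutes-reps

    σ-rep : ∀ i → σ (rep i) ≡ rep (induced i)
    σ-rep = proj₂ ∘ permutes-reps

    induced-isPawAutomorphism : IsPawAutomorphism induced
    induced-isPawAutomorphism i j = begin
      pawAdj (induced i) (induced j)        ≡⟨ sym (adj-rep (induced i) (induced j)) ⟩
      adj G (rep (induced i)) (rep (induced j)) ≡⟨ cong₂ (adj G) (sym (σ-rep i)) (sym (σ-rep j)) ⟩
      adj G (σ (rep i)) (σ (rep j))         ≡⟨ proj₂ σ-aut (rep i) (rep j) ⟩
      adj G (rep i) (rep j)                 ≡⟨ adj-rep i j ⟩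
      pawAdj i j                            ∎
      where open ≡-Reasoning

    induced-≢-swap : TypeN G f zero → induced zero ≢ suc zero
    induced-≢-swap (class0-big , class0-indep) induced0≡1
      with another-member class0-big (rep zero)
    ... | w , fw≡0 , w≢rep0 = contradiction adj-rep0-w≡true λ ()
      where
      open ≡-Reasoning
      adj-rep0-w≡true : false ≡ pawAdj (suc zero) zero
      adj-rep0-w≡true = begin
        false                           ≡⟨ sym (class0-indep (rep zero) w (f-rep zero) fw≡0) ⟩
        adj G (rep zero) w              ≡⟨ sym (proj₂ σ-aut (rep zero) w) ⟩
        adj G (σ (rep zero)) (σ w)      ≡⟨ cong₂ (adj G) (trans (σ-rep zero) (cong rep induced0≡1))
                                                         (fixes-nonRep (w≢rep0 ∘ isRep⇒≡rep fw≡0)) ⟩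
        adj G (rep (suc zero)) w        ≡⟨ adj-across-classes (f-rep (suc zero)) fw≡0 (λ ()) ⟩
        pawAdj (suc zero) zero          ∎

    induced≗id : TypeN G f zero → induced ≗ id
    induced≗id typeN =
      [ id , (λ induced≗swap → ⊥-elim (induced-≢-swap typeN (induced≗swap zero))) ]′
        (paw-automorphisms induced induced-isPawAutomorphism)

  reps-merged-distinguishing : TypeN G f zero → ∀ {k} (c : Fin n → Fin k) →
    InjectiveOutside IsRep c → Distinguishing G k c
  reps-merged-distinguishing typeN c c-inj σ σ-aut σ-pres v with c-inj (σ v) v (σ-pres v)
  ... | inj₁ σv≡v = σv≡v
  ... | inj₂ (_ , i , refl) = trans (σ-rep i) (cong rep (induced≗id typeN i))
    where open ColourPreserving c-inj σ-aut σ-pres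

  distinguishable-with-n∸3-colours : TypeN G f zero → ∃[ k ] n ≡ 3 + k × HasDistColoring G k
  distinguishable-with-n∸3-colours typeN with collapse 3 rep rep-injective
  ... | k , n≡3+k , c , c-inj = k , n≡3+k , c , reps-merged-distinguishing typeN c c-inj

lemma4p8 : ∀ (n : ℕ) (G : Graph n) (f : Fin n → Fin 4) →
    TwinGraphIsPaw G f →
    TypeN G f zero →
    Type1K G f (suc zero) →
    Type1N G f (suc (suc (suc zero))) →
    (TypeK G f (suc zero) → ¬ TypeN G f (suc (suc (suc zero))) × ¬ TypeN G f (suc (suc zero))) →
    ∀ (k : ℕ) → IsDistNumber G k → k ≢ n ∸ 2
lemma4p8 n G f paw typeN _ _ _ k (_ , minimal) k≡n∸2
  with PawTwinGraph.distinguishable-with-n∸3-colours G f paw typeN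
... | k₃ , refl , colouring = 1+n≰n (subst (_≤ k₃) k≡n∸2 (minimal k₃ colouring))
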